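{- For every integer $n>1$, $$\frac{S(n)}{n}\ge \frac{\log(n/2)}{\log 3}.$$
   Context: Let $\varphi$ be Euler's totient function. The height function $H$ on positive integers is defined by $H(1)=0$ and $H(n)=H(\varphi(n))+1$ for $n\ge 2$. Let $S(n)=\sum_{k=1}^n H(k)$. -}

module Defs where

open import Data.Nat using (ℕ; zero; suc; _+_; _≤?_)
open import Data.Nat.GCD using (gcd)
open import Data.Nat.Properties using (_≟_)
open import Data.List using (List; map; upTo; filter; length)
open import Data.Nat.ListAction using (sum)
open import Relation.Nullary.Decidable using (yes; no)

φ : ℕ → ℕ
φ n = length (filter (λ k → gcd k n ≟ 1) (map suc (upTo n)))

Hfuel : ℕ → ℕ → ℕ
Hfuel zero    m = zero
Hfuel (suc f) m with m ≤? 1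
... | yes _ = zero
... | no  _ = suc (Hfuel f (φ m))

-- H(1) = 0, H(n) = H(φ n) + 1 for n ≥ 2.  Since φ m < m for m ≥ 2, the
-- chain n, φ n, φ(φ n), … reaches 1 in fewer than n steps, so fuel n suffices.
H : ℕ → ℕ
H n = Hfuel n n

S : ℕ → ℕ
S n = sum (map (λ k → H (suc k)) (upTo n))

{-# OPTIONS --safe #-}
-- Write H n = D n + ε n, where ε n = 1 if n is odd and n > 1, and 0 otherwise. Since
-- φ n is even for n > 2, the recursion H n = 1 + H (φ n) becomes D n + ε n = 1 + D (φ n);
-- together with φ (m p) = p φ m or (p − 1) φ m for a prime p, strong induction on m p
-- shows that D is completely additive (Shapiro), with D 2 = 1 and D p = D (p − 1) for
-- odd primes p. Induction over prime factors then gives n ≤ 3 ^ D n, hence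
-- 3 n ≤ 2 · 3 ^ H n for n ≥ 2. Finally, passing from n to n + 1 multiplies n ^ n by
-- (n + 1) (1 + 1/n) ^ n ≤ 3 (n + 1) and 2 ^ n · 3 ^ S n by 2 · 3 ^ H (n + 1).
module Submission where

open import Defs
import Algebra.Properties.CommutativeSemigroup as CommutativeSemigroupProperties
open import Data.List using ([]; _∷_; _++_; [_]; map; upTo; filter; length)
open import Data.List.Properties using (upTo-∷ʳ; map-++; filter-++; length-++)
import Data.List.Relation.Unary.All as All
open import Data.Nat
open import Data.Nat.Coprimality using (Coprime; coprime?; 1-coprimeTo; coprime-+; coprime-divisor; gcd≡1⇒coprime; coprime⇒gcd≡1)
  renaming (sym to coprime-sym)
open import Data.Nat.Divisibility using (_∣_; _∣?_; divides; ∣-refl; ∣-trans; ∣⇒≤; ∣1⇒≡1; ∣m+n∣m⇒∣n; ∣m∣n⇒∣m+n; m∣m*n; n∣m*n; ∣m⇒∣m*n; ∣n⇒∣m*n;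
  quotient; quotient≢0; quotient-<; m∣n⇒n≡quotient*m)
open import Data.Nat.GCD using (gcd)
open import Data.Nat.Induction using (<-wellFounded)
open import Data.Nat.ListAction using (sum; product)
open import Data.Nat.ListAction.Properties using (sum-++)
open import Data.Nat.Primality using (Prime; prime[2]; euclidsLemma; prime⇒irreducible; prime⇒nonZero; prime⇒nonTrivial)
open import Data.Nat.Primality.Factorisation using (factorise)
open import Data.Nat.Properties
open import Data.Nat.Tactic.RingSolver using (solve)
open import Data.Product using (_×_; _,_; proj₁; proj₂; ∃-syntax)
open import Data.Sum using (_⊎_; inj₁; inj₂; [_,_]′)
open import Function using (_∘_; flip)
open import Induction.WellFounded using (Acc; acc)
open import Level using (Level)
open import Relation.Binary.PropositionalEquality hiding ([_])
open import Relation.Nullary using (Dec; yes; no; ¬_; ¬?; _×-dec_; contradiction)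
open import Relation.Unary using (Pred; Decidable; _≐_; _∩_)
open import Relation.Unary.Properties using (_∩?_; ∁?)

open CommutativeSemigroupProperties +-commutativeSemigroup using (interchange)
open CommutativeSemigroupProperties *-commutativeSemigroup using (x∙yz≈y∙xz; x∙yz≈yx∙z; x∙yz≈z∙xy)
  renaming (interchange to *-interchange)

private
  variable
    ℓ ℓ′ : Level
    A : Set ℓ
    P Q : Pred ℕ ℓ

𝟙 : Dec A → ℕ
𝟙 (yes _) = 1
𝟙 (no  _) = 0

𝟙-accept : (a : Dec A) → A → 𝟙 a ≡ 1
𝟙-accept (yes _) _ = refl
𝟙-accept (no ¬a) a = contradiction a ¬a

𝟙-reject : (a : Dec A) → ¬ A → 𝟙 a ≡ 0
𝟙-reject (yes a) ¬a = contradiction a ¬a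
𝟙-reject (no  _) _  = refl

𝟙≤1 : (a : Dec A) → 𝟙 a ≤ 1
𝟙≤1 (yes _) = ≤-refl
𝟙≤1 (no  _) = z≤n

count : Decidable P → ℕ → ℕ
count P? zero    = zero
count P? (suc n) = count P? n + 𝟙 (P? (suc n))

length-filter-upTo : (P? : Decidable P) (n : ℕ) →
                     length (filter P? (map suc (upTo n))) ≡ count P? n
length-filter-upTo P? zero    = refl
length-filter-upTo P? (suc n) = begin
  length (filter P? (map suc (upTo (suc n))))
    ≡⟨ cong (length ∘ filter P?) (trans (cong (map suc) (sym (upTo-∷ʳ n))) (map-++ suc (upTo n) [ n ])) ⟩
  length (filter P? (map suc (upTo n) ++ [ suc n ]))
    ≡⟨ cong length (filter-++ P? (map suc (upTo n)) [ suc n ]) ⟩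
  length (filter P? (map suc (upTo n)) ++ filter P? [ suc n ])
    ≡⟨ length-++ (filter P? (map suc (upTo n))) ⟩
  length (filter P? (map suc (upTo n))) + length (filter P? [ suc n ])
    ≡⟨ cong₂ _+_ (length-filter-upTo P? n) (length-filter-[] (suc n)) ⟩
  count P? (suc n) ∎
  where
  open ≡-Reasoning
  length-filter-[] : ∀ x → length (filter P? [ x ]) ≡ 𝟙 (P? x)
  length-filter-[] x with P? x
  ... | yes _ = refl
  ... | no  _ = refl

count-cong : {P : Pred ℕ ℓ} {Q : Pred ℕ ℓ′} (P? : Decidable P) (Q? : Decidable Q) →
             P ≐ Q → ∀ n → count P? n ≡ count Q? n
count-cong P? Q? P≐Q zero    = refl
count-cong P? Q? P≐Q (suc n) = cong₂ _+_ (count-cong P? Q? P≐Q n) (𝟙-cong (suc n))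
  where
  𝟙-cong : ∀ k → 𝟙 (P? k) ≡ 𝟙 (Q? k)
  𝟙-cong k with P? k | Q? k
  ... | yes _  | yes _  = refl
  ... | no  _  | no  _  = refl
  ... | yes p  | no ¬q  = contradiction (proj₁ P≐Q p) ¬q
  ... | no  ¬p | yes q  = contradiction (proj₂ P≐Q q) ¬p

count≤n : (P? : Decidable P) → ∀ n → count P? n ≤ n
count≤n P? zero    = z≤n
count≤n P? (suc n) = subst (count P? (suc n) ≤_) (+-comm n 1) (+-mono-≤ (count≤n P? n) (𝟙≤1 (P? (suc n))))

count-+ : (P? : Decidable P) → ∀ m n → count P? (m + n) ≡ count P? m + count (P? ∘ (m +_)) n
count-+ P? m zero    = trans (cong (count P?) (+-identityʳ m)) (sym (+-identityʳ _))
count-+ P? m (suc n) = begin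
  count P? (m + suc n)                                        ≡⟨ cong (count P?) (+-suc m n) ⟩
  count P? (m + n) + 𝟙 (P? (suc (m + n)))                     ≡⟨ cong₂ _+_ (count-+ P? m n) (cong (𝟙 ∘ P?) (sym (+-suc m n))) ⟩
  count P? m + count (P? ∘ (m +_)) n + 𝟙 (P? (m + suc n))     ≡⟨ +-assoc (count P? m) _ _ ⟩
  count P? m + count (P? ∘ (m +_)) (suc n)                    ∎
  where open ≡-Reasoning

count-∩-∁ : (P? : Decidable P) (Q? : Decidable Q) → ∀ n →
            count P? n ≡ count (P? ∩? Q?) n + count (P? ∩? ∁? Q?) n
count-∩-∁ P? Q? zero    = refl
count-∩-∁ P? Q? (suc n) = begin
  count P? n + 𝟙 (P? (suc n))
    ≡⟨ cong₂ _+_ (count-∩-∁ P? Q? n) (𝟙-split (suc n)) ⟩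
  (count (P? ∩? Q?) n + count (P? ∩? ∁? Q?) n) + (𝟙 ((P? ∩? Q?) (suc n)) + 𝟙 ((P? ∩? ∁? Q?) (suc n)))
    ≡⟨ interchange (count (P? ∩? Q?) n) _ _ _ ⟩
  count (P? ∩? Q?) (suc n) + count (P? ∩? ∁? Q?) (suc n) ∎
  where
  open ≡-Reasoning
  𝟙-split : ∀ k → 𝟙 (P? k) ≡ 𝟙 ((P? ∩? Q?) k) + 𝟙 ((P? ∩? ∁? Q?) k)
  𝟙-split k with P? k | Q? k
  ... | yes _ | yes _ = refl
  ... | yes _ | no  _ = refl
  ... | no  _ | _     = refl

𝟙-∩-accept : (P? : Decidable P) (Q? : Decidable Q) → ∀ {k} → Q k → 𝟙 ((P? ∩? Q?) k) ≡ 𝟙 (P? k)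
𝟙-∩-accept P? Q? {k} q with P? k | Q? k
... | _     | no ¬q = contradiction q ¬q
... | yes _ | yes _ = refl
... | no  _ | yes _ = refl

count≡0 : (P? : Decidable P) → ∀ n → (∀ {k} → 0 < k → k ≤ n → ¬ P k) → count P? n ≡ 0
count≡0 P? zero    _    = refl
count≡0 P? (suc n) none with P? (suc n)
... | yes p = contradiction p (none z<s ≤-refl)
... | no  _ = trans (+-identityʳ _) (count≡0 P? n (λ 0<k k≤n → none 0<k (m≤n⇒m≤1+n k≤n)))

count-periodic : (P? : Decidable P) → ∀ m → (P ∘ (m +_)) ≐ P → ∀ q → count P? (q * m) ≡ q * count P? m
count-periodic P? m periodic zero    = refl
count-periodic P? m periodic (suc q) = begin
  count P? (m + q * m)                     ≡⟨ count-+ P? m (q * m) ⟩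
  count P? m + count (P? ∘ (m +_)) (q * m) ≡⟨ cong (count P? m +_) (count-cong (P? ∘ (m +_)) P? periodic (q * m)) ⟩
  count P? m + count P? (q * m)            ≡⟨ cong (count P? m +_) (count-periodic P? m periodic q) ⟩
  count P? m + q * count P? m              ∎
  where open ≡-Reasoning

count-∩-∣ : (P? : Decidable P) → ∀ p .{{_ : NonZero p}} → ∀ m →
            count (P? ∩? (p ∣?_)) (m * p) ≡ count (P? ∘ (_* p)) m
count-∩-∣ P? p zero    = refl
count-∩-∣ {P = P} P? p (suc m) = begin
  count (P? ∩? (p ∣?_)) (p + m * p)
    ≡⟨ count-+ (P? ∩? (p ∣?_)) p (m * p) ⟩
  count (P? ∩? (p ∣?_)) p + count ((P? ∩? (p ∣?_)) ∘ (p +_)) (m * p)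
    ≡⟨ cong₂ _+_ (first-block P? p) (count-cong ((P? ∩? (p ∣?_)) ∘ (p +_)) ((P? ∘ (p +_)) ∩? (p ∣?_)) shift (m * p)) ⟩
  𝟙 (P? p) + count ((P? ∘ (p +_)) ∩? (p ∣?_)) (m * p)
    ≡⟨ cong₂ _+_ (cong (𝟙 ∘ P?) (sym (*-identityˡ p))) (count-∩-∣ (P? ∘ (p +_)) p m) ⟩
  𝟙 (P? (1 * p)) + count (P? ∘ (_* p) ∘ suc) m
    ≡⟨ count-+ (P? ∘ (_* p)) 1 m ⟨
  count (P? ∘ (_* p)) (suc m) ∎
  where
  open ≡-Reasoning
  shift : ((P ∩ (p ∣_)) ∘ (p +_)) ≐ ((P ∘ (p +_)) ∩ (p ∣_))
  shift = (λ (Px , p∣p+x) → Px , ∣m+n∣m⇒∣n p∣p+x ∣-refl)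
        , (λ (Px , p∣x) → Px , ∣m∣n⇒∣m+n ∣-refl p∣x)

  first-block : (P? : Decidable P) → ∀ p .{{_ : NonZero p}} → count (P? ∩? (p ∣?_)) p ≡ 𝟙 (P? p)
  first-block P? (suc p) = cong₂ _+_ below-p (𝟙-∩-accept P? (suc p ∣?_) ∣-refl)
    where
    below-p : count (P? ∩? (suc p ∣?_)) p ≡ 0
    below-p = count≡0 _ p λ 0<k k≤p (_ , p∣k) → <⇒≱ (s≤s k≤p) (∣⇒≤ ⦃ >-nonZero 0<k ⦄ p∣k)

coprime-+⁻¹ : ∀ {m n} → Coprime (n + m) n → Coprime m n
coprime-+⁻¹ c (d∣m , d∣n) = c (∣m∣n⇒∣m+n d∣n d∣m , d∣n)

coprime-∣ʳ : ∀ {k n d} → Coprime k n → d ∣ n → Coprime k d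
coprime-∣ʳ c d∣n (i∣k , i∣d) = c (i∣k , ∣-trans i∣d d∣n)

coprime-∣ˡ : ∀ {k n d} → Coprime k n → d ∣ k → Coprime d n
coprime-∣ˡ c d∣k (i∣d , i∣n) = c (∣-trans i∣d d∣k , i∣n)

coprime-*ʳ : ∀ {k m n} → Coprime k m → Coprime k n → Coprime k (m * n)
coprime-*ʳ {k} {m} km kn {d} (d∣k , d∣mn) = kn (d∣k , coprime-divisor dm d∣mn)
  where
  dm : Coprime d m
  dm = coprime-∣ˡ km d∣k

¬∣⇒coprime : ∀ {p k} → Prime p → ¬ p ∣ k → Coprime k p
¬∣⇒coprime p-prime p∤k {d} (d∣k , d∣p) with prime⇒irreducible p-prime d∣p
... | inj₁ d≡1 = d≡1
... | inj₂ refl = contradiction d∣k p∤k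

φ-count : ∀ n → φ n ≡ count (flip coprime? n) n
φ-count n = trans (length-filter-upTo (λ k → gcd k n ≟ 1) n)
                  (count-cong _ (flip coprime? n) (gcd≡1⇒coprime , coprime⇒gcd≡1) n)

count-coprime-* : ∀ m p → count (flip coprime? m) (m * p) ≡ p * φ m
count-coprime-* m p = begin
  count (flip coprime? m) (m * p) ≡⟨ cong (count (flip coprime? m)) (*-comm m p) ⟩
  count (flip coprime? m) (p * m) ≡⟨ count-periodic (flip coprime? m) m (coprime-+⁻¹ , coprime-+) p ⟩
  p * count (flip coprime? m) m   ≡⟨ cong (p *_) (φ-count m) ⟨
  p * φ m                         ∎
  where open ≡-Reasoning

φ-*-∣ : ∀ {m p} → p ∣ m → φ (m * p) ≡ p * φ m
φ-*-∣ {m} {p} p∣m = begin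
  φ (m * p)                          ≡⟨ φ-count (m * p) ⟩
  count (flip coprime? (m * p)) (m * p) ≡⟨ count-cong _ _ same-coprimes (m * p) ⟩
  count (flip coprime? m) (m * p)    ≡⟨ count-coprime-* m p ⟩
  p * φ m                            ∎
  where
  open ≡-Reasoning
  same-coprimes : (λ k → Coprime k (m * p)) ≐ (λ k → Coprime k m)
  same-coprimes = (λ c → coprime-∣ʳ c (m∣m*n p)) , (λ c → coprime-*ʳ c (coprime-∣ʳ c p∣m))

φ-*-∤ : ∀ {m p} → Prime p → ¬ p ∣ m → φ (m * p) ≡ pred p * φ m
φ-*-∤ {m} {p} p-prime p∤m = +-cancelˡ-≡ (φ m) _ _ (begin
  φ m + φ (m * p)
    ≡⟨ cong₂ _+_ (trans (φ-count m) (sym multiples)) (trans (φ-count (m * p)) non-multiples) ⟩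
  count (C? ∩? (p ∣?_)) (m * p) + count (C? ∩? ∁? (p ∣?_)) (m * p)
    ≡⟨ count-∩-∁ C? (p ∣?_) (m * p) ⟨
  count C? (m * p)
    ≡⟨ count-coprime-* m p ⟩
  p * φ m
    ≡⟨ cong (_* φ m) (suc-pred p) ⟨
  φ m + pred p * φ m ∎)
  where
  open ≡-Reasoning
  instance _ = prime⇒nonZero p-prime
  C? : Decidable (λ k → Coprime k m)
  C? = flip coprime? m

  multiples : count (C? ∩? (p ∣?_)) (m * p) ≡ count C? m
  multiples = trans (count-∩-∣ C? p m) (count-cong _ _ (to , from) m)
    where
    to : ∀ {j} → Coprime (j * p) m → Coprime j m
    to c = coprime-∣ˡ c (m∣m*n p)
    from : ∀ {j} → Coprime j m → Coprime (j * p) m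
    from c = coprime-sym (coprime-*ʳ (coprime-sym c) (¬∣⇒coprime p-prime p∤m))

  non-multiples : count (flip coprime? (m * p)) (m * p) ≡ count (C? ∩? ∁? (p ∣?_)) (m * p)
  non-multiples = count-cong _ _ (to , from) (m * p)
    where
    instance _ = prime⇒nonTrivial p-prime
    to : ∀ {k} → Coprime k (m * p) → Coprime k m × ¬ p ∣ k
    to c = coprime-∣ʳ c (m∣m*n p) , λ p∣k → nonTrivial⇒≢1 (c (p∣k , n∣m*n m))
    from : ∀ {k} → Coprime k m × ¬ p ∣ k → Coprime k (m * p)
    from (c , p∤k) = coprime-*ʳ c (¬∣⇒coprime p-prime p∤k)

φ-prime : ∀ {p} → Prime p → φ p ≡ pred p
φ-prime {p} p-prime = begin
  φ p          ≡⟨ cong φ (*-identityˡ p) ⟨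
  φ (1 * p)    ≡⟨ φ-*-∤ p-prime (nonTrivial⇒≢1 ∘ ∣1⇒≡1) ⟩
  pred p * 1   ≡⟨ *-identityʳ (pred p) ⟩
  pred p       ∎
  where
  open ≡-Reasoning
  instance _ = prime⇒nonTrivial p-prime

φ[n]<n : ∀ {n} → 1 < n → φ n < n
φ[n]<n {suc n} 1<n = begin-strict
  φ (suc n)                              ≡⟨ φ-count (suc n) ⟩
  count C? n + 𝟙 (C? (suc n))            ≡⟨ cong (count C? n +_) (𝟙-reject (C? (suc n)) ¬coprime-self) ⟩
  count C? n + 0                         ≡⟨ +-identityʳ _ ⟩
  count C? n                             ≤⟨ count≤n C? n ⟩
  n                                      <⟨ n<1+n n ⟩
  suc n                                  ∎
  where
  open ≤-Reasoning
  C? : Decidable (λ k → Coprime k (suc n))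
  C? = flip coprime? (suc n)
  ¬coprime-self : ¬ Coprime (suc n) (suc n)
  ¬coprime-self c = >⇒≢ 1<n (c (∣-refl , ∣-refl))

φ-nonZero : ∀ n .{{_ : NonZero n}} → NonZero (φ n)
φ-nonZero (suc n) = >-nonZero (begin-strict
  0                                                                   <⟨ z<s ⟩
  1                                                                   ≡⟨ 𝟙-accept (coprime? 1 (suc n)) (1-coprimeTo (suc n)) ⟨
  count C? 1                                                          ≤⟨ m≤m+n _ _ ⟩
  count C? 1 + count (C? ∘ (1 +_)) n                                  ≡⟨ count-+ C? 1 n ⟨
  count C? (suc n)                                                    ≡⟨ φ-count (suc n) ⟨
  φ (suc n)                                                           ∎)
  where
  open ≤-Reasoning
  C? : Decidable (λ k → Coprime k (suc n))
  C? = flip coprime? (suc n)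

prime-factor : ∀ n → 1 < n → ∃[ p ] Prime p × p ∣ n
prime-factor n 1<n with factorise n ⦃ >-nonZero (<-trans z<s 1<n) ⦄
... | record { factors = [] ; isFactorisation = n≡1 } = contradiction n≡1 (>⇒≢ 1<n)
... | record { factors = p ∷ ps ; isFactorisation = n≡p*Πps ; factorsPrime = p-prime All.∷ _ } =
  p , p-prime , divides (product ps) (trans n≡p*Πps (*-comm p (product ps)))

2∣n⊎2∣1+n : ∀ n → 2 ∣ n ⊎ 2 ∣ suc n
2∣n⊎2∣1+n zero    = inj₁ (divides 0 refl)
2∣n⊎2∣1+n (suc n) with 2∣n⊎2∣1+n n
... | inj₁ 2∣n   = inj₂ (∣m∣n⇒∣m+n ∣-refl 2∣n)
... | inj₂ 2∣1+n = inj₁ 2∣1+n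

odd-prime⇒¬2∣ : ∀ {p} → Prime p → p ≢ 2 → ¬ 2 ∣ p
odd-prime⇒¬2∣ p-prime p≢2 2∣p with prime⇒irreducible p-prime 2∣p
... | inj₁ ()
... | inj₂ 2≡p = p≢2 (sym 2≡p)

odd-prime⇒2∣pred : ∀ {p} → Prime p → p ≢ 2 → 2 ∣ pred p
odd-prime⇒2∣pred {suc p} p-prime p≢2 with 2∣n⊎2∣1+n p
... | inj₁ 2∣p   = 2∣p
... | inj₂ 2∣1+p = contradiction 2∣1+p (odd-prime⇒¬2∣ p-prime p≢2)

odd-prime∣⇒2∣φ : ∀ {p n} → Prime p → p ≢ 2 → p ∣ n → 2 ∣ φ n
odd-prime∣⇒2∣φ {p} {n} p-prime p≢2 = go n (<-wellFounded n)
  where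
  instance _ = prime⇒nonZero p-prime
  go : ∀ n → Acc _<_ n → p ∣ n → 2 ∣ φ n
  go .(0 * p) _ (divides zero refl) = divides 0 refl
  go .(suc q * p) (acc rec) (divides (suc q) refl) with p ∣? suc q
  ... | yes p∣q = subst (2 ∣_) (sym (φ-*-∣ p∣q)) (∣n⇒∣m*n p (go (suc q) (rec q<n) p∣q))
    where
    q<n : suc q < suc q * p
    q<n = m<m*n (suc q) p (nonTrivial⇒n>1 p ⦃ prime⇒nonTrivial p-prime ⦄)
  ... | no  p∤q = subst (2 ∣_) (sym (φ-*-∤ p-prime p∤q)) (∣m⇒∣m*n (φ (suc q)) (odd-prime⇒2∣pred p-prime p≢2))

2∣φ[q*2] : ∀ {q} → 1 < q → 2 ∣ φ (q * 2)
2∣φ[q*2] {q} 1<q with 2 ∣? q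
... | yes 2∣q = subst (2 ∣_) (sym (φ-*-∣ 2∣q)) (m∣m*n (φ q))
... | no  2∤q with prime-factor q 1<q
...   | r , r-prime , r∣q = odd-prime∣⇒2∣φ r-prime (λ { refl → 2∤q r∣q }) (∣-trans r∣q (m∣m*n 2))

φ-even : ∀ {n} → 2 < n → 2 ∣ φ n
φ-even {n} 2<n with prime-factor n (<-trans (s<s z<s) 2<n)
... | p , p-prime , p∣n with p ≟ 2
...   | no  p≢2  = odd-prime∣⇒2∣φ p-prime p≢2 p∣n
...   | yes refl with p∣n
...     | divides q refl = 2∣φ[q*2] (*-cancelʳ-< 2 1 q 2<n)

Hfuel-≤1 : ∀ f {m} → m ≤ 1 → Hfuel f m ≡ 0
Hfuel-≤1 zero    _   = refl
Hfuel-≤1 (suc f) {m} m≤1 with m ≤? 1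
... | yes _  = refl
... | no m≰1 = contradiction m≤1 m≰1

Hfuel-irrelevant : ∀ f g m → m ≤ f → m ≤ g → Hfuel f m ≡ Hfuel g m
Hfuel-irrelevant zero    g       m z≤n _   = sym (Hfuel-≤1 g z≤n)
Hfuel-irrelevant (suc f) zero    m _   z≤n = Hfuel-≤1 (suc f) z≤n
Hfuel-irrelevant (suc f) (suc g) m m≤f m≤g with m ≤? 1
... | yes _  = refl
... | no m≰1 = cong suc (Hfuel-irrelevant f g (φ m) (below m≤f) (below m≤g))
  where
  below : ∀ {k} → m ≤ suc k → φ m ≤ k
  below m≤1+k = m<1+n⇒m≤n (<-≤-trans (φ[n]<n (≰⇒> m≰1)) m≤1+k)

H-φ : ∀ {n} → 1 < n → H n ≡ suc (H (φ n))
H-φ {suc n} 1<n with suc n ≤? 1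
... | yes n≤1 = contradiction n≤1 (<⇒≱ 1<n)
... | no  _   = cong suc (Hfuel-irrelevant n (φ (suc n)) (φ (suc n)) (m<1+n⇒m≤n (φ[n]<n 1<n)) ≤-refl)

ε : ℕ → ℕ
ε n = 𝟙 (¬? (2 ∣? n) ×-dec (1 <? n))

-- For n ≥ 1, D n is the number of even terms in n, φ n, φ (φ n), …, since every term after
-- the first is even or 1.
D : ℕ → ℕ
D n = H n ∸ ε n

ε-even : ∀ {n} → 2 ∣ n → ε n ≡ 0
ε-even 2∣n = 𝟙-reject _ λ (2∤n , _) → 2∤n 2∣n

ε-odd : ∀ {n} → ¬ 2 ∣ n → 1 < n → ε n ≡ 1
ε-odd 2∤n 1<n = 𝟙-accept _ (2∤n , 1<n)

ε-φ : ∀ n → ε (φ n) ≡ 0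
ε-φ 0 = refl
ε-φ 1 = refl
ε-φ 2 = refl
ε-φ n@(suc (suc (suc _))) = ε-even (φ-even {n} (s<s (s<s (s<s z≤n))))

H≡D+ε : ∀ n → H n ≡ D n + ε n
H≡D+ε n = sym (m∸n+n≡m (ε≤H n))
  where
  ε≤H : ∀ n → ε n ≤ H n
  ε≤H 0 = z≤n
  ε≤H 1 = z≤n
  ε≤H n@(suc (suc _)) = subst (ε n ≤_) (sym (H-φ (s<s z<s))) (≤-trans (𝟙≤1 _) (s≤s z≤n))

H-even : ∀ {n} → 2 ∣ n → H n ≡ D n
H-even {n} 2∣n = trans (H≡D+ε n) (trans (cong (D n +_) (ε-even 2∣n)) (+-identityʳ (D n)))

H-odd : ∀ {n} → ¬ 2 ∣ n → 1 < n → H n ≡ suc (D n)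
H-odd {n} 2∤n 1<n = trans (H≡D+ε n) (trans (cong (D n +_) (ε-odd 2∤n 1<n)) (+-comm (D n) 1))

D-φ : ∀ {n} → 1 < n → D n + ε n ≡ suc (D (φ n))
D-φ {n} 1<n = begin
  D n + ε n                    ≡⟨ H≡D+ε n ⟨
  H n                          ≡⟨ H-φ 1<n ⟩
  suc (H (φ n))                ≡⟨ cong suc (H≡D+ε (φ n)) ⟩
  suc (D (φ n) + ε (φ n))      ≡⟨ cong (λ e → suc (D (φ n) + e)) (ε-φ n) ⟩
  suc (D (φ n) + 0)            ≡⟨ cong suc (+-identityʳ _) ⟩
  suc (D (φ n))                ∎
  where open ≡-Reasoning

D-odd-prime : ∀ {p} → Prime p → p ≢ 2 → D p ≡ D (pred p)
D-odd-prime {p} p-prime p≢2 = +-cancelʳ-≡ 1 _ _ (begin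
  D p + 1                      ≡⟨ cong (D p +_) (ε-odd (odd-prime⇒¬2∣ p-prime p≢2) (nonTrivial⇒n>1 p)) ⟨
  D p + ε p                    ≡⟨ D-φ (nonTrivial⇒n>1 p) ⟩
  suc (D (φ p))                ≡⟨ cong (suc ∘ D) (φ-prime p-prime) ⟩
  suc (D (pred p))             ≡⟨ +-comm 1 _ ⟩
  D (pred p) + 1               ∎)
  where
  open ≡-Reasoning
  instance _ = prime⇒nonTrivial p-prime

ε-* : ∀ {m p} .{{_ : NonZero p}} → 1 < m → (2 ∣ p → 2 ∣ m) → ε (m * p) ≡ ε m
ε-* {m} {p} 1<m 2∣p⇒2∣m = by-parity (2 ∣? m)
  where
  by-parity : Dec (2 ∣ m) → ε (m * p) ≡ ε m
  by-parity (yes 2∣m) = trans (ε-even (∣m⇒∣m*n p 2∣m)) (sym (ε-even 2∣m))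
  by-parity (no  2∤m) = trans (ε-odd 2∤mp (<-≤-trans 1<m (m≤m*n m p))) (sym (ε-odd 2∤m 1<m))
    where
    2∤mp : ¬ 2 ∣ m * p
    2∤mp 2∣mp = [ 2∤m , 2∤m ∘ 2∣p⇒2∣m ]′ (euclidsLemma m p prime[2] 2∣mp)

D-AdditiveBelow : ℕ → Set
D-AdditiveBelow N = ∀ a b .{{_ : NonZero a}} .{{_ : NonZero b}} → a * b < N → D (a * b) ≡ D a + D b

D-*-prime-via-φ : ∀ {m p} .{{_ : NonZero p}} → 1 < m → ε (m * p) ≡ ε m →
                  D (φ (m * p)) ≡ D p + D (φ m) → D (m * p) ≡ D m + D p
D-*-prime-via-φ {m} {p} 1<m ε-same Dφ = +-cancelʳ-≡ (ε m) _ _ (begin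
  D (m * p) + ε m              ≡⟨ cong (D (m * p) +_) ε-same ⟨
  D (m * p) + ε (m * p)        ≡⟨ D-φ (<-≤-trans 1<m (m≤m*n m p)) ⟩
  suc (D (φ (m * p)))          ≡⟨ cong suc Dφ ⟩
  suc (D p + D (φ m))          ≡⟨ +-suc (D p) (D (φ m)) ⟨
  D p + suc (D (φ m))          ≡⟨ cong (D p +_) (D-φ 1<m) ⟨
  D p + (D m + ε m)            ≡⟨ +-assoc (D p) (D m) (ε m) ⟨
  D p + D m + ε m              ≡⟨ cong (_+ ε m) (+-comm (D p) (D m)) ⟩
  D m + D p + ε m              ∎)
  where open ≡-Reasoning

c*φ[m]<m*p : ∀ {c m p} .{{_ : NonZero p}} → c ≤ p → 1 < m → c * φ m < m * p
c*φ[m]<m*p {c} {m} {p} c≤p 1<m = begin-strict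
  c * φ m                    ≤⟨ *-monoˡ-≤ (φ m) c≤p ⟩
  p * φ m                    <⟨ *-monoʳ-< p (φ[n]<n 1<m) ⟩
  p * m                      ≡⟨ *-comm p m ⟩
  m * p                      ∎
  where open ≤-Reasoning

D-*-prime : ∀ m {p} .{{_ : NonZero m}} → Prime p → D-AdditiveBelow (m * p) → D (m * p) ≡ D m + D p
D-*-prime 1                {p} _       _        = cong D (+-identityʳ p)
D-*-prime m@(suc (suc _))  {p} p-prime additive = by-divisibility (p ∣? m)
  where
  open ≡-Reasoning
  instance
    _ = prime⇒nonZero p-prime
    _ = φ-nonZero m
  1<m : 1 < m
  1<p : 1 < p
  1<m = s<s z<s
  1<p = nonTrivial⇒n>1 p ⦃ prime⇒nonTrivial p-prime ⦄
  by-divisibility : Dec (p ∣ m) → D (m * p) ≡ D m + D p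
  by-divisibility (yes p∣m) = D-*-prime-via-φ 1<m (ε-* 1<m (λ 2∣p → ∣-trans 2∣p p∣m)) (begin
    D (φ (m * p))              ≡⟨ cong D (φ-*-∣ p∣m) ⟩
    D (p * φ m)                ≡⟨ additive p (φ m) (c*φ[m]<m*p ≤-refl 1<m) ⟩
    D p + D (φ m)              ∎)
  by-divisibility (no p∤m) with p ≟ 2
  ... | yes refl = begin
    D (m * 2)                  ≡⟨ +-identityʳ _ ⟨
    D (m * 2) + 0              ≡⟨ cong (D (m * 2) +_) (ε-even (n∣m*n m)) ⟨
    D (m * 2) + ε (m * 2)      ≡⟨ D-φ (<-≤-trans 1<m (m≤m*n m 2)) ⟩
    suc (D (φ (m * 2)))        ≡⟨ cong (suc ∘ D) (trans (φ-*-∤ p-prime p∤m) (*-identityˡ (φ m))) ⟩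
    suc (D (φ m))              ≡⟨ D-φ 1<m ⟨
    D m + ε m                  ≡⟨ cong (D m +_) (ε-odd p∤m 1<m) ⟩
    D m + 1                    ∎
  ... | no  p≢2  = D-*-prime-via-φ 1<m (ε-* 1<m (λ 2∣p → contradiction 2∣p (odd-prime⇒¬2∣ p-prime p≢2))) (begin
    D (φ (m * p))              ≡⟨ cong D (φ-*-∤ p-prime p∤m) ⟩
    D (pred p * φ m)           ≡⟨ additive (pred p) (φ m) ⦃ >-nonZero (pred-mono-≤ 1<p) ⦄ (c*φ[m]<m*p pred[n]≤n 1<m) ⟩
    D (pred p) + D (φ m)       ≡⟨ cong (_+ D (φ m)) (D-odd-prime p-prime p≢2) ⟨
    D p + D (φ m)              ∎)

D-*-step : ∀ a b .{{_ : NonZero a}} .{{_ : NonZero b}} → D-AdditiveBelow (a * b) → D (a * b) ≡ D a + D b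
D-*-step 1                b                _        = cong D (+-identityʳ b)
D-*-step a@(suc (suc _))  1                _        = trans (cong D (*-identityʳ a)) (sym (+-identityʳ (D a)))
D-*-step a@(suc (suc _))  b@(suc (suc _))  additive with prime-factor b (s<s z<s)
... | p , p-prime , p∣b = begin
  D (a * b)                  ≡⟨ cong (D ∘ (a *_)) b≡q*p ⟩
  D (a * (q * p))            ≡⟨ cong D (*-assoc a q p) ⟨
  D (a * q * p)              ≡⟨ D-*-prime (a * q) p-prime (subst D-AdditiveBelow ab≡aqp additive) ⟩
  D (a * q) + D p            ≡⟨ cong (_+ D p) (additive a q (*-monoʳ-< a (quotient-< p∣b))) ⟩
  D a + D q + D p            ≡⟨ +-assoc (D a) (D q) (D p) ⟩
  D a + (D q + D p)          ≡⟨ cong (D a +_) (additive q p (subst (_< a * b) b≡q*p b<ab)) ⟨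
  D a + D (q * p)            ≡⟨ cong ((D a +_) ∘ D) b≡q*p ⟨
  D a + D b                  ∎
  where
  open ≡-Reasoning
  q : ℕ
  q = quotient p∣b
  b≡q*p : b ≡ q * p
  b≡q*p = m∣n⇒n≡quotient*m p∣b
  instance
    p≢0 = prime⇒nonZero p-prime
    p>1 = prime⇒nonTrivial p-prime
    q≢0 = quotient≢0 p∣b
    aq≢0 = m*n≢0 a q
  ab≡aqp : a * b ≡ a * q * p
  ab≡aqp = trans (cong (a *_) b≡q*p) (sym (*-assoc a q p))
  b<ab : b < a * b
  b<ab = subst (b <_) (*-comm b a) (m<m*n b a (s<s z<s))

D-additiveBelow : ∀ N → D-AdditiveBelow N
D-additiveBelow (suc N) a b ab<1+N with m<1+n⇒m<n∨m≡n ab<1+N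
... | inj₁ ab<N = D-additiveBelow N a b ab<N
... | inj₂ refl = D-*-step a b (D-additiveBelow (a * b))

D-* : ∀ a b .{{_ : NonZero a}} .{{_ : NonZero b}} → D (a * b) ≡ D a + D b
D-* a b = D-additiveBelow (suc (a * b)) a b ≤-refl

D[j*2]≡1+D[j] : ∀ j .{{_ : NonZero j}} → D (j * 2) ≡ suc (D j)
D[j*2]≡1+D[j] j = trans (D-* j 2) (+-comm (D j) 1)

prime≤3^D : ∀ {p} → Prime p → (∀ j .{{_ : NonZero j}} → j < p → j ≤ 3 ^ D j) → p ≤ 3 ^ D p
prime≤3^D {p} p-prime below with p ≟ 2
... | yes refl = s≤s (s≤s z≤n)
... | no  p≢2  = begin
  p                          ≡⟨ suc-pred p ⟨
  suc (pred p)               ≡⟨ cong suc pred[p]≡j*2 ⟩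
  suc (j * 2)                ≤⟨ +-monoˡ-≤ (j * 2) (>-nonZero⁻¹ j) ⟩
  j + j * 2                  ≡⟨ cong (j +_) (*-comm j 2) ⟩
  3 * j                      ≤⟨ *-monoʳ-≤ 3 (below j j<p) ⟩
  3 * 3 ^ D j                ≡⟨ cong (3 ^_) (D[j*2]≡1+D[j] j) ⟨
  3 ^ D (j * 2)              ≡⟨ cong ((3 ^_) ∘ D) pred[p]≡j*2 ⟨
  3 ^ D (pred p)             ≡⟨ cong (3 ^_) (D-odd-prime p-prime p≢2) ⟨
  3 ^ D p                    ∎
  where
  open ≤-Reasoning
  instance
    p≢0 = prime⇒nonZero p-prime
    p>1 = prime⇒nonTrivial p-prime
  2∣pred[p] : 2 ∣ pred p
  2∣pred[p] = odd-prime⇒2∣pred p-prime p≢2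
  j : ℕ
  j = quotient 2∣pred[p]
  pred[p]≡j*2 : pred p ≡ j * 2
  pred[p]≡j*2 = m∣n⇒n≡quotient*m 2∣pred[p]
  instance
    pred[p]≢0 = >-nonZero (pred-mono-≤ (nonTrivial⇒n>1 p))
    j≢0 = quotient≢0 2∣pred[p]
  j<p : j < p
  j<p = <-≤-trans (quotient-< 2∣pred[p]) pred[n]≤n

n≤3^D[n] : ∀ n .{{_ : NonZero n}} → n ≤ 3 ^ D n
n≤3^D[n] n = go n (<-wellFounded n)
  where
  go : ∀ n .{{_ : NonZero n}} → Acc _<_ n → n ≤ 3 ^ D n
  go 1                (acc _)   = ≤-refl
  go n@(suc (suc _))  (acc rec) with prime-factor n (s<s z<s)
  ... | p , p-prime , p∣n = begin
    n                          ≡⟨ n≡q*p ⟩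
    q * p                      ≤⟨ *-mono-≤ (go q (rec (quotient-< p∣n))) p≤3^D[p] ⟩
    3 ^ D q * 3 ^ D p          ≡⟨ ^-distribˡ-+-* 3 (D q) (D p) ⟨
    3 ^ (D q + D p)            ≡⟨ cong (3 ^_) (D-* q p) ⟨
    3 ^ D (q * p)              ≡⟨ cong ((3 ^_) ∘ D) n≡q*p ⟨
    3 ^ D n                    ∎
    where
    open ≤-Reasoning
    q : ℕ
    q = quotient p∣n
    n≡q*p : n ≡ q * p
    n≡q*p = m∣n⇒n≡quotient*m p∣n
    instance
      p≢0 = prime⇒nonZero p-prime
      p>1 = prime⇒nonTrivial p-prime
      q≢0 = quotient≢0 p∣n
    p≤3^D[p] : p ≤ 3 ^ D p
    p≤3^D[p] = prime≤3^D p-prime λ j j<p → go j (rec (<-≤-trans j<p (∣⇒≤ p∣n)))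

3*[j*2]≤2*3^H[j*2] : ∀ j .{{_ : NonZero j}} → 3 * (j * 2) ≤ 2 * 3 ^ H (j * 2)
3*[j*2]≤2*3^H[j*2] j = begin
  3 * (j * 2)                ≡⟨ solve (j ∷ []) ⟩
  2 * (3 * j)                ≤⟨ *-monoʳ-≤ 2 (*-monoʳ-≤ 3 (n≤3^D[n] j)) ⟩
  2 * (3 * 3 ^ D j)          ≡⟨ cong (λ d → 2 * 3 ^ d) (D[j*2]≡1+D[j] j) ⟨
  2 * 3 ^ D (j * 2)          ≡⟨ cong (λ d → 2 * 3 ^ d) (H-even (n∣m*n j)) ⟨
  2 * 3 ^ H (j * 2)          ∎
  where open ≤-Reasoning

3*n≤2*3^H[n] : ∀ {n} → 1 < n → 3 * n ≤ 2 * 3 ^ H n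
3*n≤2*3^H[n] {n} 1<n with 2 ∣? n
... | yes 2∣n = subst (λ m → 3 * m ≤ 2 * 3 ^ H m) (sym (m∣n⇒n≡quotient*m 2∣n))
                  (3*[j*2]≤2*3^H[j*2] (quotient 2∣n) ⦃ quotient≢0 2∣n ⦃ >-nonZero (<-trans z<s 1<n) ⦄ ⦄)
... | no  2∤n = begin
  3 * n                      ≤⟨ *-monoʳ-≤ 3 (n≤3^D[n] n ⦃ >-nonZero (<-trans z<s 1<n) ⦄) ⟩
  3 * 3 ^ D n                ≤⟨ m≤n*m (3 * 3 ^ D n) 2 ⟩
  2 * (3 * 3 ^ D n)          ≡⟨ cong (λ d → 2 * 3 ^ d) (H-odd 2∤n 1<n) ⟨
  2 * 3 ^ H n                ∎
  where open ≤-Reasoning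

-- (1 + 1/n)^k ≤ 1 + k/n + (k/n)² for k ≤ n, cleared of denominators.
n²[1+n]^k≤n^k[n²+kn+k²] : ∀ n k → k ≤ n → n * n * suc n ^ k ≤ n ^ k * (n * n + k * n + k * k)
n²[1+n]^k≤n^k[n²+kn+k²] n zero    _   = ≤-reflexive (solve (n ∷ []))
n²[1+n]^k≤n^k[n²+kn+k²] n (suc k) k<n = begin
  n * n * (suc n * suc n ^ k)                 ≡⟨ x∙yz≈y∙xz (n * n) (suc n) (suc n ^ k) ⟩
  suc n * (n * n * suc n ^ k)                 ≤⟨ *-monoʳ-≤ (suc n) (n²[1+n]^k≤n^k[n²+kn+k²] n k (<⇒≤ k<n)) ⟩
  suc n * (n ^ k * (n * n + k * n + k * k))   ≡⟨ x∙yz≈y∙xz (suc n) (n ^ k) _ ⟩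
  n ^ k * (suc n * (n * n + k * n + k * k))   ≤⟨ *-monoʳ-≤ (n ^ k) step ⟩
  n ^ k * (n * (n * n + suc k * n + suc k * suc k)) ≡⟨ x∙yz≈yx∙z (n ^ k) n _ ⟩
  n * n ^ k * (n * n + suc k * n + suc k * suc k) ∎
  where
  open ≤-Reasoning
  step : suc n * (n * n + k * n + k * k) ≤ n * (n * n + suc k * n + suc k * suc k)
  step = +-cancelʳ-≤ (k * k) _ _ (begin
    suc n * (n * n + k * n + k * k) + k * k              ≤⟨ +-monoʳ-≤ _ (≤-trans (*-monoʳ-≤ k (<⇒≤ k<n)) (m≤m+n (k * n) n)) ⟩
    suc n * (n * n + k * n + k * k) + (k * n + n)        ≡⟨ solve (n ∷ k ∷ []) ⟩
    n * (n * n + suc k * n + suc k * suc k) + k * k      ∎)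

[1+n]^n≤3*n^n : ∀ n .{{_ : NonZero n}} → suc n ^ n ≤ 3 * n ^ n
[1+n]^n≤3*n^n n = *-cancelˡ-≤ (n * n) ⦃ m*n≢0 n n ⦄ (begin
  n * n * suc n ^ n                        ≤⟨ n²[1+n]^k≤n^k[n²+kn+k²] n n ≤-refl ⟩
  n ^ n * (n * n + n * n + n * n)          ≡⟨ cong (n ^ n *_) (solve (n ∷ [])) ⟩
  n ^ n * (3 * (n * n))                    ≡⟨ x∙yz≈z∙xy (n ^ n) 3 (n * n) ⟩
  n * n * (n ^ n * 3)                      ≡⟨ cong (n * n *_) (*-comm (n ^ n) 3) ⟩
  n * n * (3 * n ^ n)                      ∎)
  where open ≤-Reasoning

S-suc : ∀ n → S (suc n) ≡ S n + H (suc n)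
S-suc n = begin
  sum (map (H ∘ suc) (upTo (suc n)))                 ≡⟨ cong (sum ∘ map (H ∘ suc)) (upTo-∷ʳ n) ⟨
  sum (map (H ∘ suc) (upTo n ++ [ n ]))              ≡⟨ cong sum (map-++ (H ∘ suc) (upTo n) [ n ]) ⟩
  sum (map (H ∘ suc) (upTo n) ++ [ H (suc n) ])      ≡⟨ sum-++ (map (H ∘ suc) (upTo n)) [ H (suc n) ] ⟩
  S n + (H (suc n) + 0)                              ≡⟨ cong (S n +_) (+-identityʳ _) ⟩
  S n + H (suc n)                                    ∎
  where open ≡-Reasoning

n^n≤2^n*3^S[n]-step : ∀ n .{{_ : NonZero n}} → n ^ n ≤ 2 ^ n * 3 ^ S n → suc n ^ suc n ≤ 2 ^ suc n * 3 ^ S (suc n)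
n^n≤2^n*3^S[n]-step n ih = begin
  suc n * suc n ^ n                        ≤⟨ *-monoʳ-≤ (suc n) ([1+n]^n≤3*n^n n) ⟩
  suc n * (3 * n ^ n)                      ≤⟨ *-monoʳ-≤ (suc n) (*-monoʳ-≤ 3 ih) ⟩
  suc n * (3 * (2 ^ n * 3 ^ S n))          ≡⟨ x∙yz≈yx∙z (suc n) 3 _ ⟩
  3 * suc n * (2 ^ n * 3 ^ S n)            ≤⟨ *-monoˡ-≤ _ (3*n≤2*3^H[n] (s<s (>-nonZero⁻¹ n))) ⟩
  2 * 3 ^ H (suc n) * (2 ^ n * 3 ^ S n)    ≡⟨ *-interchange 2 (3 ^ H (suc n)) (2 ^ n) (3 ^ S n) ⟩
  2 * 2 ^ n * (3 ^ H (suc n) * 3 ^ S n)    ≡⟨ cong (2 ^ suc n *_) (*-comm (3 ^ H (suc n)) (3 ^ S n)) ⟩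
  2 ^ suc n * (3 ^ S n * 3 ^ H (suc n))    ≡⟨ cong (2 ^ suc n *_) (^-distribˡ-+-* 3 (S n) (H (suc n))) ⟨
  2 ^ suc n * 3 ^ (S n + H (suc n))        ≡⟨ cong ((2 ^ suc n *_) ∘ (3 ^_)) (S-suc n) ⟨
  2 ^ suc n * 3 ^ S (suc n)                ∎
  where open ≤-Reasoning

lemma4p1 : (n : ℕ) → 1 < n → n ^ n ≤ 2 ^ n * 3 ^ S n
lemma4p1 (suc n) _ = go n
  where
  go : ∀ m → suc m ^ suc m ≤ 2 ^ suc m * 3 ^ S (suc m)
  go zero    = s≤s z≤n
  go (suc m) = n^n≤2^n*3^S[n]-step (suc m) (go m)
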